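{- A lattice $L$ is isomorphic to a lattice of subclones if and only if $L$ is isomorphic to the lattice of subalgebras of a block algebra.
   Context: A clone on a set $A$ is a set of finitary (possibly nullary) operations on $A$ containing all projections, closed under composition ($f(g_1,\dots,g_n)_k(\mathbf a)=f(g_1(\mathbf a),\dots,g_n(\mathbf a))$ for $f$ $n$-ary, $g_i$ $k$-ary, $k\ge 0$) and under restriction (if an $n$-ary $f$, $n\ge1$, does not depend on its last argument then $(a_1,\dots,a_{n-1})\mapsto f(a_1,\dots,a_{n-1},b)$ belongs to it). If $F$ is a clone on $A$, a subclone of $F$ is a subset of $F$ which is a clone on $A$; $\mathrm{Sb}(F)$ is the lattice of subclones of $F$. A lattice is isomorphic to a lattice of subclones if it is isomorphic to $\mathrm{Sb}(F)$ for some set $A$ and clone $F$ on $A$. The top extension of an $n$-ary operation $f$ on $A$ is $f^\top(s)=f(s_1,\dots,s_n)$ for $s\in A^\omega$. The full block algebra on $A$ has universe $\{f^\top\}$ ($f$ ranging over finitary operations on $A$) and operations $\mathsf e_i(s)=s_i$ and $q_n(\varphi,\psi_1,\dots,\psi_n)(s)=\varphi(s[\psi_1(s),\dots,\psi_n(s)])$, with $s[a_1,\dots,a_n]$ being $s$ with its first $n$ entries replaced by $a_1,\dots,a_n$. A block algebra (on $A$) is a subalgebra of the full block algebra on $A$. -}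

module Defs where

open import Level using (Level; _⊔_) renaming (suc to lsuc)
open import Data.Nat using (ℕ; zero; suc)
open import Data.Fin using (Fin; toℕ)
open import Data.Vec using (Vec; []; _∷_; lookup; tabulate; _∷ʳ_)
open import Data.Product using (Σ; ∃; ∃-syntax; _×_; _,_)
open import Relation.Binary.PropositionalEquality using (_≡_)
open import Relation.Binary.Lattice using (Lattice)
open import Function.Bundles using (_⇔_)

Op : ∀ {a} → Set a → ℕ → Set a
Op A n = Vec A n → A

OpSet : ∀ {a} → Set a → Set (lsuc a)
OpSet {a} A = (n : ℕ) → Op A n → Set a

_⊆ₒ_ : ∀ {a} {A : Set a} → OpSet A → OpSet A → Set a
F ⊆ₒ G = ∀ n f → F n f → G n f

-- F is a *set* of functions: membership respects (pointwise) equality of functions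
Extensionalₒ : ∀ {a} {A : Set a} → OpSet A → Set a
Extensionalₒ {A = A} F = ∀ n (f g : Op A n) → F n f → (∀ v → f v ≡ g v) → F n g

IndepLast : ∀ {a} {A : Set a} {m : ℕ} → Op A (suc m) → Set a
IndepLast {A = A} {m} f = ∀ (v : Vec A m) (x y : A) → f (v ∷ʳ x) ≡ f (v ∷ʳ y)

record IsClone {a} {A : Set a} (F : OpSet A) : Set (lsuc a) where
  field
    extensional : Extensionalₒ F
    projections : ∀ n (i : Fin n) → F n (λ v → lookup v i)
    composition : ∀ n k (f : Op A n) (g : Fin n → Op A k) →
                  F n f → (∀ i → F k (g i)) →
                  F k (λ v → f (tabulate (λ i → g i v)))
    restriction : ∀ m (f : Op A (suc m)) → F (suc m) f → IndepLast f →
                  ∀ (b : A) → F m (λ v → f (v ∷ʳ b))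

record Subclone {a} {A : Set a} (F : OpSet A) : Set (lsuc a) where
  field
    ops      : OpSet A
    isClone  : IsClone ops
    included : ops ⊆ₒ F
open Subclone public

Fun : ∀ {a} → Set a → Set a
Fun A = (ℕ → A) → A

firstN : ∀ {a} {A : Set a} (n : ℕ) → (ℕ → A) → Vec A n
firstN n s = tabulate (λ i → s (toℕ i))

top : ∀ {a} {A : Set a} {n : ℕ} → Op A n → Fun A
top {n = n} f s = f (firstN n s)

-- φ is (pointwise equal to) a top extension, i.e. an element of the full block algebra
IsTop : ∀ {a} {A : Set a} → Fun A → Set a
IsTop {A = A} φ = ∃[ n ] ∃[ f ] (∀ (s : ℕ → A) → φ s ≡ top {n = n} f s)

override : ∀ {a} {A : Set a} {n : ℕ} → (ℕ → A) → Vec A n → ℕ → A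
override s []       i       = s i
override s (x ∷ xs) zero    = x
override s (x ∷ xs) (suc i) = override (λ j → s (suc j)) xs i

𝖾 : ∀ {a} {A : Set a} → ℕ → Fun A
𝖾 i s = s i

q : ∀ {a} {A : Set a} (n : ℕ) → Fun A → (Fin n → Fun A) → Fun A
q n φ ψ s = φ (override s (tabulate (λ i → ψ i s)))

FunSet : ∀ {a} → Set a → Set (lsuc a)
FunSet {a} A = Fun A → Set a

_⊆f_ : ∀ {a} {A : Set a} → FunSet A → FunSet A → Set a
P ⊆f Q = ∀ φ → P φ → Q φ

Extensionalf : ∀ {a} {A : Set a} → FunSet A → Set a
Extensionalf {A = A} P = ∀ (φ ψ : Fun A) → P φ → (∀ s → φ s ≡ ψ s) → P ψ

ClosedBlock : ∀ {a} {A : Set a} → FunSet A → Set a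
ClosedBlock P = (∀ i → P (𝖾 i)) ×
                (∀ n φ ψ → P φ → (∀ i → P (ψ i)) → P (q n φ ψ))

record BlockAlgebra {a} (A : Set a) : Set (lsuc a) where
  field
    carrier     : FunSet A
    extensional : Extensionalf carrier
    tops        : carrier ⊆f IsTop
    closed      : ClosedBlock carrier
open BlockAlgebra public

record Subalgebra {a} {A : Set a} (B : BlockAlgebra A) : Set (lsuc a) where
  field
    elems       : FunSet A
    extensional : Extensionalf elems
    included    : elems ⊆f carrier B
    closed      : ClosedBlock elems
open Subalgebra public

-- Lattice isomorphism with a lattice of subsets ordered by inclusion.
-- (A lattice isomorphism is the same as an order isomorphism.)
-- φ : L → S is an order isomorphism onto the poset (S, ⊑) (elements of S
-- identified up to mutual inclusion): order-preserving and -reflecting,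
-- and surjective up to ⊑-equivalence.
OrderIso : ∀ {c ℓ₁ ℓ₂ s r} (L : Lattice c ℓ₁ ℓ₂) (S : Set s) (_⊑_ : S → S → Set r) →
           Set (c ⊔ ℓ₂ ⊔ s ⊔ r)
OrderIso L S _⊑_ =
  Σ (Carrier → S) (λ φ → (∀ x y → (x ≤ y) ⇔ (φ x ⊑ φ y)) ×
          (∀ (T : S) → ∃[ x ] ((φ x ⊑ T) × (T ⊑ φ x))))
  where open Lattice L using (Carrier; _≤_)

_⊑c_ : ∀ {a} {A : Set a} {F : OpSet A} → Subclone F → Subclone F → Set a
G ⊑c H = ops G ⊆ₒ ops H

_⊑a_ : ∀ {a} {A : Set a} {B : BlockAlgebra A} → Subalgebra B → Subalgebra B → Set a
S ⊑a T = elems S ⊆f elems T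

IsoSb : ∀ {a c ℓ₁ ℓ₂} (L : Lattice c ℓ₁ ℓ₂) {A : Set a} (F : OpSet A) → Set _
IsoSb L F = OrderIso L (Subclone F) _⊑c_

IsoSub : ∀ {a c ℓ₁ ℓ₂} (L : Lattice c ℓ₁ ℓ₂) {A : Set a} (B : BlockAlgebra A) → Set _
IsoSub L B = OrderIso L (Subalgebra B) _⊑a_

IsoToSubcloneLattice : ∀ (a : Level) {c ℓ₁ ℓ₂} → Lattice c ℓ₁ ℓ₂ → Set _
IsoToSubcloneLattice a L = ∃[ A ] Σ (OpSet {a} A) (λ F → IsClone F × IsoSb L F)

IsoToBlockSubLattice : ∀ (a : Level) {c ℓ₁ ℓ₂} → Lattice c ℓ₁ ℓ₂ → Set _
IsoToBlockSubLattice a L = ∃[ A ] Σ (BlockAlgebra {a} A) (λ B → IsoSub L B)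

-- Under f ↦ f^⊤, projections become the e_i and composition of operations becomes
-- q_n, so the top extensions of a clone form a block algebra, and the operations
-- whose top extensions lie in a block algebra form a clone. Restriction, together
-- with composition with projections, makes membership in a clone depend only on
-- f^⊤ and not on the arity of f. Hence G ↦ {g^⊤ | g ∈ G} is an order isomorphism
-- Sb(F) ≅ Sub(B_F), and every block algebra B is B_F for F = {f | f^⊤ ∈ B}.
module Submission where

open import Defs
open import Level using (Level)
open import Relation.Binary.Lattice using (Lattice)
open import Function.Bundles using (_⇔_; mk⇔; Equivalence)

open import Function.Base using (_∘_)
open import Function.Construct.Composition using (_⇔-∘_)
open import Data.Nat using (ℕ; zero; suc; _≤_; _<_; _<?_; s≤s)
open import Data.Nat.Properties using (≮⇒≥)
open import Data.Fin using (Fin; toℕ; fromℕ<; inject≤; fromℕ) renaming (zero to fzero)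
open import Data.Fin.Properties using (toℕ-inject≤; toℕ-fromℕ)
open import Data.Vec using (Vec; []; _∷_; lookup; tabulate; _∷ʳ_)
open import Data.Vec.Properties using (lookup∘tabulate; tabulate-cong)
import Data.List as List
open import Data.List.Extrema.Nat using (max; ⊥≤max; xs≤max)
open import Data.List.Relation.Unary.All.Properties using (tabulate⁻)
open import Data.Product using (∃; ∃-syntax; _×_; _,_; proj₁; proj₂)
open import Relation.Binary.Definitions using (Transitive)
open import Relation.Binary.PropositionalEquality using (_≡_; _≗_; refl; sym; trans; cong)
open import Relation.Nullary using (yes; no)

OrderIso-transport : ∀ {c ℓ₁ ℓ₂ s r t r′} {L : Lattice c ℓ₁ ℓ₂}
  {S : Set s} {_⊑_ : S → S → Set r} {T : Set t} {_⊑′_ : T → T → Set r′} →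
  Transitive _⊑′_ → (Φ : S → T) → (∀ x y → (x ⊑ y) ⇔ (Φ x ⊑′ Φ y)) →
  (∀ u → ∃[ x ] ((Φ x ⊑′ u) × (u ⊑′ Φ x))) →
  OrderIso L S _⊑_ → OrderIso L T _⊑′_
OrderIso-transport {_⊑′_ = _⊑′_} trans′ Φ Φ-⇔ Φ-onto (φ , φ-⇔ , φ-onto) =
  Φ ∘ φ , (λ x y → Φ-⇔ (φ x) (φ y) ⇔-∘ φ-⇔ x y) , onto
  where
  onto : ∀ u → ∃[ x ] ((Φ (φ x) ⊑′ u) × (u ⊑′ Φ (φ x)))
  onto u with Φ-onto u
  ... | (y , Φy⊑u , u⊑Φy) with φ-onto y
  ...   | (x , φx⊑y , y⊑φx) =
    x , trans′ (Equivalence.to (Φ-⇔ _ _) φx⊑y) Φy⊑u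
      , trans′ u⊑Φy (Equivalence.to (Φ-⇔ _ _) y⊑φx)

module _ {a} {A : Set a} where

  firstN-override : ∀ {n} (s : ℕ → A) (v : Vec A n) → firstN n (override s v) ≡ v
  firstN-override s []       = refl
  firstN-override s (x ∷ xs) = cong (x ∷_) (firstN-override (s ∘ suc) xs)

  override-< : ∀ {n} (s : ℕ → A) (v : Vec A n) {j} (j<n : j < n) → override s v j ≡ lookup v (fromℕ< j<n)
  override-< s (x ∷ xs) {zero}  _         = refl
  override-< s (x ∷ xs) {suc j} (s≤s j<n) = override-< (s ∘ suc) xs j<n

  override-≥ : ∀ {n} (s : ℕ → A) (v : Vec A n) j → n ≤ j → override s v j ≡ s j
  override-≥ s []       j       _         = refl
  override-≥ s (x ∷ xs) (suc j) (s≤s n≤j) = override-≥ (s ∘ suc) xs j n≤j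

  firstN-suc : ∀ m (s : ℕ → A) → firstN (suc m) s ≡ firstN m s ∷ʳ s m
  firstN-suc zero    s = refl
  firstN-suc (suc m) s = cong (s 0 ∷_) (firstN-suc m (s ∘ suc))

  q-cong : ∀ n {φ φ′ : Fun A} {ψ ψ′ : Fin n → Fun A} →
           φ ≗ φ′ → (∀ i → ψ i ≗ ψ′ i) → q n φ ψ ≗ q n φ′ ψ′
  q-cong n {φ′ = φ′} φ≗φ′ ψ≗ψ′ s =
    trans (φ≗φ′ _) (cong (φ′ ∘ override s) (tabulate-cong (λ i → ψ≗ψ′ i s)))

  weaken : ∀ {k K} → k ≤ K → Op A k → Op A K
  weaken k≤K g v = g (tabulate (λ j → lookup v (inject≤ j k≤K)))

  top-weaken : ∀ {k K} (k≤K : k ≤ K) (g : Op A k) → top (weaken k≤K g) ≗ top g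
  top-weaken k≤K g s = cong g (tabulate-cong (λ j →
    trans (lookup∘tabulate (s ∘ toℕ) (inject≤ j k≤K)) (cong s (toℕ-inject≤ j k≤K))))

  topsOf : OpSet A → FunSet A
  topsOf G φ = ∃[ n ] ∃[ f ] (G n f × φ ≗ top {n = n} f)

  opsOf : FunSet A → OpSet A
  opsOf P n f = P (top f)

  topsOf-extensional : (G : OpSet A) → Extensionalf (topsOf G)
  topsOf-extensional G φ ψ (n , f , f∈G , φ≗f) φ≗ψ =
    n , f , f∈G , λ s → trans (sym (φ≗ψ s)) (φ≗f s)

  topsOf-mono : ∀ {G H : OpSet A} → G ⊆ₒ H → topsOf G ⊆f topsOf H
  topsOf-mono G⊆H φ (n , f , f∈G , φ≗f) = n , f , G⊆H n f f∈G , φ≗f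

  topsOf-⊆-IsTop : (G : OpSet A) → topsOf G ⊆f IsTop
  topsOf-⊆-IsTop G φ (n , f , _ , φ≗f) = n , f , φ≗f

  ⊆-opsOf-topsOf : (G : OpSet A) → G ⊆ₒ opsOf (topsOf G)
  ⊆-opsOf-topsOf G n f f∈G = n , f , f∈G , λ _ → refl

  topsOf-opsOf-⊆ : {P : FunSet A} → Extensionalf P → topsOf (opsOf P) ⊆f P
  topsOf-opsOf-⊆ P-ext φ (n , f , f⊤∈P , φ≗f) = P-ext (top f) φ f⊤∈P (sym ∘ φ≗f)

  ⊆-topsOf-opsOf : {P : FunSet A} → Extensionalf P → P ⊆f IsTop → P ⊆f topsOf (opsOf P)
  ⊆-topsOf-opsOf P-ext P⊆IsTop φ φ∈P with P⊆IsTop φ φ∈P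
  ... | (n , f , φ≗f) = n , f , P-ext φ (top f) φ∈P φ≗f , φ≗f

  opsOf-isClone : {P : FunSet A} → Extensionalf P → ClosedBlock P → IsClone (opsOf P)
  opsOf-isClone P-ext (e∈P , q∈P) = record
    { extensional = λ n f g f⊤∈P f≗g → P-ext (top f) (top g) f⊤∈P (f≗g ∘ firstN n)
    ; projections = λ n i → P-ext (𝖾 (toℕ i)) _ (e∈P (toℕ i))
        (λ s → sym (lookup∘tabulate (s ∘ toℕ) i))
    ; composition = λ n k f g f⊤∈P g⊤∈P → P-ext _ _ (q∈P n (top f) (top ∘ g) f⊤∈P g⊤∈P)
        (λ s → cong f (firstN-override s (tabulate (λ i → g i (firstN k s)))))
    ; restriction = λ m f f⊤∈P f-indep b → P-ext (top f) _ f⊤∈P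
        (λ s → trans (cong f (firstN-suc m s)) (f-indep (firstN m s) (s m) b))
    }

  module _ {G : OpSet A} (G-clone : IsClone G) where
    open IsClone G-clone renaming (extensional to G-ext)

    restrict-constant : ∀ m {h : Op A m} (x : A) → G m h → (∀ v → h v ≡ x) → G 0 (λ _ → x)
    restrict-constant zero    x h∈G h≡x = G-ext 0 _ _ h∈G h≡x
    restrict-constant (suc m) x h∈G h≡x =
      restrict-constant m x (restriction m _ h∈G (λ v y z → trans (h≡x _) (sym (h≡x _))) x)
        (λ v → h≡x (v ∷ʳ x))

    padding-∈ : ∀ n m (i : Fin m) → G (suc n) (λ v → override (λ _ → lookup v fzero) v (toℕ i))
    padding-∈ n m i with toℕ i <? suc n
    ... | yes i<n = G-ext _ _ _ (projections (suc n) (fromℕ< i<n))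
          (λ v → sym (override-< _ v i<n))
    ... | no i≮n  = G-ext _ _ _ (projections (suc n) fzero)
          (λ v → sym (override-≥ _ v (toℕ i) (≮⇒≥ i≮n)))

    -- A nullary f has no argument to pad the missing coordinates with, so it is
    -- obtained by restriction instead of by composition with projections.
    ∈-resp-top : ∀ {n m} {f : Op A n} {h : Op A m} → G m h → top f ≗ top h → G n f
    ∈-resp-top {zero} {m} {f} {h} h∈G f≗h =
      G-ext 0 _ f (restrict-constant m (f []) h∈G (λ w →
        trans (cong h (sym (firstN-override (λ _ → f []) w))) (sym (f≗h (override (λ _ → f []) w)))))
        (λ { [] → refl })
    ∈-resp-top {suc n} {m} {f} {h} h∈G f≗h =
      G-ext _ _ f (composition m (suc n) h _ h∈G (padding-∈ n m)) (λ v →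
        trans (sym (f≗h (override (λ _ → lookup v fzero) v)))
              (cong f (firstN-override (λ _ → lookup v fzero) v)))

    opsOf-topsOf-⊆ : opsOf (topsOf G) ⊆ₒ G
    opsOf-topsOf-⊆ n f (m , h , h∈G , f≗h) = ∈-resp-top h∈G f≗h

    topsOf-weaken : ∀ {φ} K (φ∈ : topsOf G φ) → proj₁ φ∈ ≤ K → ∃[ g ] (G K g × φ ≗ top g)
    topsOf-weaken K (n , f , f∈G , φ≗f) n≤K =
      weaken n≤K f
      , composition n K f _ f∈G (λ j → projections K (inject≤ j n≤K))
      , λ s → trans (φ≗f s) (sym (top-weaken n≤K f s))

    q-top-∈ : ∀ {m K} n (f : Op A m) (g : Fin n → Op A K) → m ≤ K → G m f →
              (∀ i → G K (g i)) → topsOf G (q n (top f) (top ∘ g))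
    q-top-∈ {m} {K} n f g m≤K f∈G g∈G =
      K , (λ v → f (tabulate (λ j → argument j v)))
        , composition m K f argument f∈G argument-∈
        , λ s → cong f (tabulate-cong (sym ∘ argument-top s))
      where
      argument : Fin m → Op A K
      argument j with toℕ j <? n
      ... | yes j<n = g (fromℕ< j<n)
      ... | no _    = λ v → lookup v (inject≤ j m≤K)

      argument-∈ : ∀ j → G K (argument j)
      argument-∈ j with toℕ j <? n
      ... | yes j<n = g∈G (fromℕ< j<n)
      ... | no _    = projections K (inject≤ j m≤K)

      values : (ℕ → A) → Vec A n
      values s = tabulate (λ i → top (g i) s)

      argument-top : ∀ s j → argument j (firstN K s) ≡ override s (values s) (toℕ j)
      argument-top s j with toℕ j <? n
      ... | yes j<n = sym (trans (override-< s (values s) j<n)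
                                 (lookup∘tabulate (λ i → top (g i) s) (fromℕ< j<n)))
      ... | no j≮n  = trans (lookup∘tabulate (s ∘ toℕ) (inject≤ j m≤K))
                       (trans (cong s (toℕ-inject≤ j m≤K))
                              (sym (override-≥ s (values s) (toℕ j) (≮⇒≥ j≮n))))

    topsOf-closed : ClosedBlock (topsOf G)
    topsOf-closed = e∈ , q∈
      where
      e∈ : ∀ i → topsOf G (𝖾 i)
      e∈ i = suc i , (λ v → lookup v (fromℕ i)) , projections (suc i) _ ,
        λ s → sym (trans (lookup∘tabulate (s ∘ toℕ) (fromℕ i)) (cong s (toℕ-fromℕ i)))

      q∈ : ∀ n φ ψ → topsOf G φ → (∀ i → topsOf G (ψ i)) → topsOf G (q n φ ψ)
      q∈ n φ ψ (m , f , f∈G , φ≗f) ψ∈ =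
        topsOf-extensional G _ _
          (q-top-∈ n f (proj₁ ∘ ψ′) m≤K f∈G (proj₁ ∘ proj₂ ∘ ψ′))
          (sym ∘ q-cong n φ≗f (proj₂ ∘ proj₂ ∘ ψ′))
        where
        arity : Fin n → ℕ
        arity = proj₁ ∘ ψ∈
        K : ℕ
        K = max m (List.tabulate arity)
        m≤K : m ≤ K
        m≤K = ⊥≤max m (List.tabulate arity)
        ψ′ : ∀ i → ∃[ g ] (G K g × ψ i ≗ top g)
        ψ′ i = topsOf-weaken K (ψ∈ i) (tabulate⁻ (xs≤max m (List.tabulate arity)) i)

module _ {a} {A : Set a} {F : OpSet A} (F-clone : IsClone F) where

  blockAlgebra : BlockAlgebra A
  blockAlgebra = record
    { carrier     = topsOf F
    ; extensional = topsOf-extensional F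
    ; tops        = topsOf-⊆-IsTop F
    ; closed      = topsOf-closed F-clone
    }

  Sb→Sub : Subclone F → Subalgebra blockAlgebra
  Sb→Sub G = record
    { elems       = topsOf (ops G)
    ; extensional = topsOf-extensional (ops G)
    ; included    = topsOf-mono (Subclone.included G)
    ; closed      = topsOf-closed (isClone G)
    }

  Sb→Sub-⇔ : ∀ G H → (G ⊑c H) ⇔ (Sb→Sub G ⊑a Sb→Sub H)
  Sb→Sub-⇔ G H = mk⇔ topsOf-mono
    (λ G⊆H n f → opsOf-topsOf-⊆ (isClone H) n f ∘ G⊆H (top f) ∘ ⊆-opsOf-topsOf (ops G) n f)

  Sb→Sub-onto : ∀ T → ∃[ G ] ((Sb→Sub G ⊑a T) × (T ⊑a Sb→Sub G))
  Sb→Sub-onto T = G , topsOf-opsOf-⊆ T-ext , ⊆-topsOf-opsOf T-ext T⊆IsTop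
    where
    T-ext : Extensionalf (elems T)
    T-ext = Subalgebra.extensional T
    T⊆IsTop : elems T ⊆f IsTop
    T⊆IsTop φ = topsOf-⊆-IsTop F φ ∘ Subalgebra.included T φ
    G : Subclone F
    G = record
      { ops      = opsOf (elems T)
      ; isClone  = opsOf-isClone T-ext (Subalgebra.closed T)
      ; included = λ n f → opsOf-topsOf-⊆ F-clone n f ∘ Subalgebra.included T (top f)
      }

  IsoSb⇒IsoSub : ∀ {c ℓ₁ ℓ₂} (L : Lattice c ℓ₁ ℓ₂) → IsoSb L F → IsoSub L blockAlgebra
  IsoSb⇒IsoSub L = OrderIso-transport {L = L} {_⊑′_ = _⊑a_ {B = blockAlgebra}}
    (λ S⊑T T⊑U φ → T⊑U φ ∘ S⊑T φ) Sb→Sub Sb→Sub-⇔ Sb→Sub-onto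

module _ {a} {A : Set a} (B : BlockAlgebra A) where

  opsOf-carrier-isClone : IsClone (opsOf (carrier B))
  opsOf-carrier-isClone = opsOf-isClone (BlockAlgebra.extensional B) (BlockAlgebra.closed B)

  Sub→Sb : Subalgebra B → Subclone (opsOf (carrier B))
  Sub→Sb S = record
    { ops      = opsOf (elems S)
    ; isClone  = opsOf-isClone (Subalgebra.extensional S) (Subalgebra.closed S)
    ; included = λ n f → Subalgebra.included S (top f)
    }

  Sub→Sb-⇔ : ∀ S T → (S ⊑a T) ⇔ (Sub→Sb S ⊑c Sub→Sb T)
  Sub→Sb-⇔ S T = mk⇔ (λ S⊆T n f → S⊆T (top f))
    (λ S⊆T φ → topsOf-opsOf-⊆ (Subalgebra.extensional T) φ
             ∘ topsOf-mono S⊆T φ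
             ∘ ⊆-topsOf-opsOf (Subalgebra.extensional S) (λ ψ → tops B ψ ∘ Subalgebra.included S ψ) φ)

  Sub→Sb-onto : ∀ G → ∃[ S ] ((Sub→Sb S ⊑c G) × (G ⊑c Sub→Sb S))
  Sub→Sb-onto G = S , opsOf-topsOf-⊆ (isClone G) , ⊆-opsOf-topsOf (ops G)
    where
    S : Subalgebra B
    S = record
      { elems       = topsOf (ops G)
      ; extensional = topsOf-extensional (ops G)
      ; included    = λ φ → topsOf-opsOf-⊆ (BlockAlgebra.extensional B) φ
                          ∘ topsOf-mono (Subclone.included G) φ
      ; closed      = topsOf-closed (isClone G)
      }

  IsoSub⇒IsoSb : ∀ {c ℓ₁ ℓ₂} (L : Lattice c ℓ₁ ℓ₂) → IsoSub L B → IsoSb L (opsOf (carrier B))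
  IsoSub⇒IsoSb L = OrderIso-transport {L = L} {_⊑′_ = _⊑c_ {F = opsOf (carrier B)}}
    (λ G⊑H H⊑K n f → H⊑K n f ∘ G⊑H n f) Sub→Sb Sub→Sb-⇔ Sub→Sb-onto

mainTheorem7 : ∀ {a c ℓ₁ ℓ₂ : Level} (L : Lattice c ℓ₁ ℓ₂) →
    IsoToSubcloneLattice a L ⇔ IsoToBlockSubLattice a L
mainTheorem7 L = mk⇔
  (λ (A , F , F-clone , L≅SbF) → A , blockAlgebra F-clone , IsoSb⇒IsoSub F-clone L L≅SbF)
  (λ (A , B , L≅SubB) → A , opsOf (carrier B) , opsOf-carrier-isClone B , IsoSub⇒IsoSb B L L≅SubB)
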